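{- For every odd positive integer $\ell$, $B_\ell\ \le\ \dfrac{2^\ell}{\ell}$.
   Context: A bidirectional ballot sequence is a finite 0-1 sequence such that every nonempty prefix and every nonempty suffix contains strictly more ones than zeros. $B_\ell$ denotes the number of bidirectional ballot sequences of length $\ell$. -}

module Defs where

open import Data.Bool using (Bool; true; false)
open import Data.Nat using (ℕ; zero; suc; _+_; _<_; _<?_)
open import Data.List using (List; []; _∷_; map; length; take; drop; filter; _++_)
open import Data.List.Relation.Unary.All using (All; all?)
open import Data.Nat.Base using (_≤_)
open import Relation.Nullary using (Dec; ¬_)
open import Relation.Nullary.Decidable using (_×-dec_)
open import Data.Product using (_×_)
open import Relation.Unary using (Decidable)

-- 0-1 sequences are lists of Bool (true = 1, false = 0).

ones : List Bool → ℕ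
ones [] = 0
ones (true ∷ xs) = suc (ones xs)
ones (false ∷ xs) = ones xs

zeros : List Bool → ℕ
zeros [] = 0
zeros (true ∷ xs) = zeros xs
zeros (false ∷ xs) = suc (zeros xs)

MoreOnes : List Bool → Set
MoreOnes xs = zeros xs < ones xs

moreOnes? : (xs : List Bool) → Dec (MoreOnes xs)
moreOnes? xs = zeros xs <? ones xs

oneTo : ℕ → List ℕ
oneTo zero = []
oneTo (suc n) = oneTo n ++ (suc n ∷ [])

prefixes : List Bool → List (List Bool)
prefixes xs = map (λ k → take k xs) (oneTo (length xs))

zeroTo : ℕ → List ℕ
zeroTo zero = []
zeroTo (suc n) = zeroTo n ++ (n ∷ [])

suffixes : List Bool → List (List Bool)
suffixes xs = map (λ k → drop k xs) (zeroTo (length xs))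

IsBallot : List Bool → Set
IsBallot xs = All MoreOnes (prefixes xs) × All MoreOnes (suffixes xs)

isBallot? : Decidable IsBallot
isBallot? xs = all? moreOnes? (prefixes xs) ×-dec all? moreOnes? (suffixes xs)

allSeqs : ℕ → List (List Bool)
allSeqs zero = [] ∷ []
allSeqs (suc n) = map (true ∷_) (allSeqs n) ++ map (false ∷_) (allSeqs n)

B : ℕ → ℕ
B ℓ = length (filter isBallot? (allSeqs ℓ))

open import Relation.Binary.PropositionalEquality using (_≡_; refl)
_ : B 1 ≡ 1
_ = refl
_ : B 3 ≡ 1
_ = refl
_ : B 5 ≡ 2
_ = refl
_ : B 7 ≡ 5
_ = refl

module Submission where

-- B ℓ ≤ 2^ℓ / ℓ, proved for every length ℓ.
--
-- Idea: cut a bidirectional ballot sequence x = u ++ v after its first k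
-- letters (0 ≤ k < ℓ) and form the word  v ++ complement u.  These ℓ · B ℓ
-- words are pairwise distinct.  Indeed, if v ++ ū = v' ++ ū' with different
-- cut points, some nonempty word c satisfies v' = v ++ c and ū = c ++ ū'.
-- Then c ends the ballot sequence u' ++ v ++ c, so it has more ones than
-- zeros, while complement c begins the ballot sequence complement c ++ u' ++ v,
-- so c has more zeros than ones — a contradiction.  Counting the words of
-- length ℓ gives ℓ · B ℓ ≤ 2^ℓ.

open import Defs
open import Data.Nat using (ℕ; zero; suc; _+_; _*_; _^_; _≤_; _<_; _⊓_; s≤s; z≤n)
open import Data.Nat.Properties
  using (<⇒≤; <-asym; ≤-trans; ≤-reflexive; m<1+n⇒m<n∨m≡n; m<m+n; m≤n⇒m⊓n≡m; +-comm; +-identityʳ)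
open import Data.Bool using (Bool; true; false; not)
open import Data.Bool.Properties using (not-involutive)
open import Data.List using (List; []; _∷_; head; map; length; take; drop; filter; _++_; upTo; cartesianProduct)
open import Data.List.Properties
  using (length-++; length-map; length-take; length-++-≤ˡ; take++drop≡id; ++-assoc; map-++; map-∘; map-cong; map-id; length-upTo)
open import Data.List.Membership.Propositional using (_∈_)
open import Data.List.Membership.Propositional.Properties
  using (∈-map⁺; ∈-map⁻; ∈-++⁺ˡ; ∈-++⁺ʳ; ∈-++⁻; ∈-filter⁻; ∈-upTo⁻; ∈-cartesianProduct⁻)
open import Data.List.Relation.Unary.Any using (here; there)
open import Data.List.Relation.Unary.All as All using ([])
open import Data.List.Relation.Unary.AllPairs using ([]; _∷_)
open import Data.List.Relation.Unary.Unique.Propositional using (Unique)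
open import Data.List.Relation.Unary.Unique.Propositional.Properties
  using (++⁺; map⁺; filter⁺; upTo⁺; cartesianProduct⁺)
open import Data.Product using (_×_; _,_)
open import Data.Sum using (inj₁; inj₂)
open import Data.Empty using (⊥; ⊥-elim)
open import Relation.Nullary using (¬_)
open import Relation.Binary.PropositionalEquality
  using (_≡_; _≢_; refl; sym; trans; cong; cong₂; subst; subst₂; module ≡-Reasoning)

private
  variable
    X Y : Set

remove : {y : X} {ys : List X} → y ∈ ys → List X
remove {ys = _ ∷ ys} (here _)  = ys
remove {ys = y ∷ _}  (there p) = y ∷ remove p

length-remove : {y : X} {ys : List X} (p : y ∈ ys) → length ys ≡ suc (length (remove p))
length-remove (here _)  = refl
length-remove (there p) = cong suc (length-remove p)

∈-remove : {x y : X} {ys : List X} → x ∈ ys → x ≢ y → (p : y ∈ ys) → x ∈ remove p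
∈-remove (here x≡z) x≢y (here y≡z) = ⊥-elim (x≢y (trans x≡z (sym y≡z)))
∈-remove (there q)  _   (here _)   = q
∈-remove (here x≡z) _   (there _)  = here x≡z
∈-remove (there q)  x≢y (there p)  = there (∈-remove q x≢y p)

injectiveOn-length-≤ : (f : X → Y) {xs : List X} {ys : List Y} → Unique xs →
  (∀ {x} → x ∈ xs → f x ∈ ys) →
  (∀ {x y} → x ∈ xs → y ∈ xs → f x ≡ f y → x ≡ y) →
  length xs ≤ length ys
injectiveOn-length-≤ f {[]} _ _ _ = z≤n
injectiveOn-length-≤ f {x ∷ xs} (x∉xs ∷ xs!) into inj =
  ≤-trans (s≤s (injectiveOn-length-≤ f xs! into′ (λ p q → inj (there p) (there q))))
          (≤-reflexive (sym (length-remove (into (here refl)))))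
  where
  into′ : ∀ {y} → y ∈ xs → f y ∈ remove (into (here refl))
  into′ y∈xs = ∈-remove (into (there y∈xs))
    (λ fy≡fx → All.lookup x∉xs y∈xs (inj (here refl) (there y∈xs) (sym fy≡fx)))
    (into (here refl))

length-cartesianProduct : (xs : List X) (ys : List Y) →
  length (cartesianProduct xs ys) ≡ length xs * length ys
length-cartesianProduct []       ys = refl
length-cartesianProduct (x ∷ xs) ys = begin
  length (map (x ,_) ys ++ cartesianProduct xs ys)          ≡⟨ length-++ (map (x ,_) ys) ⟩
  length (map (x ,_) ys) + length (cartesianProduct xs ys)  ≡⟨ cong₂ _+_ (length-map _ ys) (length-cartesianProduct xs ys) ⟩
  length ys + length xs * length ys                         ∎
  where open ≡-Reasoning

length-allSeqs : ∀ n → length (allSeqs n) ≡ 2 ^ n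
length-allSeqs zero    = refl
length-allSeqs (suc n) = begin
  length (map (true ∷_) (allSeqs n) ++ map (false ∷_) (allSeqs n))      ≡⟨ length-++ (map (true ∷_) (allSeqs n)) ⟩
  length (map (true ∷_) (allSeqs n)) + length (map (false ∷_) (allSeqs n)) ≡⟨ cong₂ _+_ (length-map _ (allSeqs n)) (length-map _ (allSeqs n)) ⟩
  length (allSeqs n) + length (allSeqs n)                               ≡⟨ cong₂ _+_ (length-allSeqs n) (trans (length-allSeqs n) (sym (+-identityʳ (2 ^ n)))) ⟩
  2 ^ n + (2 ^ n + 0)                                                   ∎
  where open ≡-Reasoning

∈-allSeqs⁺ : (w : List Bool) → w ∈ allSeqs (length w)
∈-allSeqs⁺ []          = here refl
∈-allSeqs⁺ (true ∷ w)  = ∈-++⁺ˡ (∈-map⁺ (true ∷_) (∈-allSeqs⁺ w))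
∈-allSeqs⁺ (false ∷ w) = ∈-++⁺ʳ (map (true ∷_) (allSeqs (length w))) (∈-map⁺ (false ∷_) (∈-allSeqs⁺ w))

∈-allSeqs⁻ : ∀ n {w : List Bool} → w ∈ allSeqs n → length w ≡ n
∈-allSeqs⁻ zero    (here refl) = refl
∈-allSeqs⁻ (suc n) w∈ with ∈-++⁻ (map (true ∷_) (allSeqs n)) w∈
... | inj₁ w∈₁ with _ , v∈ , refl ← ∈-map⁻ (true ∷_) w∈₁  = cong suc (∈-allSeqs⁻ n v∈)
... | inj₂ w∈₂ with _ , v∈ , refl ← ∈-map⁻ (false ∷_) w∈₂ = cong suc (∈-allSeqs⁻ n v∈)

allSeqs-unique : ∀ n → Unique (allSeqs n)
allSeqs-unique zero    = [] ∷ []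
allSeqs-unique (suc n) =
  ++⁺ (map⁺ (λ { refl → refl }) (allSeqs-unique n))
      (map⁺ (λ { refl → refl }) (allSeqs-unique n))
      first-letters-differ
  where
  first-letters-differ : ∀ {w} → ¬ (w ∈ map (true ∷_) (allSeqs n) × w ∈ map (false ∷_) (allSeqs n))
  first-letters-differ (w∈₁ , w∈₂) with ∈-map⁻ _ w∈₁ | ∈-map⁻ _ w∈₂
  ... | _ , _ , refl | _ , _ , ()

suc-∈-oneTo : ∀ {i n} → i < n → suc i ∈ oneTo n
suc-∈-oneTo {i} {suc n} i<1+n with m<1+n⇒m<n∨m≡n i<1+n
... | inj₁ i<n  = ∈-++⁺ˡ (suc-∈-oneTo i<n)
... | inj₂ refl = ∈-++⁺ʳ (oneTo n) (here refl)

∈-zeroTo : ∀ {i n} → i < n → i ∈ zeroTo n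
∈-zeroTo {i} {suc n} i<1+n with m<1+n⇒m<n∨m≡n i<1+n
... | inj₁ i<n  = ∈-++⁺ˡ (∈-zeroTo i<n)
... | inj₂ refl = ∈-++⁺ʳ (zeroTo n) (here refl)

take-length-++ : (p q : List X) → take (length p) (p ++ q) ≡ p
take-length-++ []      q = refl
take-length-++ (b ∷ p) q = cong (b ∷_) (take-length-++ p q)

drop-length-++ : (p q : List X) → drop (length p) (p ++ q) ≡ q
drop-length-++ []      q = refl
drop-length-++ (b ∷ p) q = drop-length-++ p q

prefix-moreOnes : ∀ b p q → IsBallot ((b ∷ p) ++ q) → MoreOnes (b ∷ p)
prefix-moreOnes b p q (prefixesOK , _) =
  subst MoreOnes (take-length-++ (b ∷ p) q)
    (All.lookup prefixesOK (∈-map⁺ (λ k → take k ((b ∷ p) ++ q)) (suc-∈-oneTo (s≤s (length-++-≤ˡ p)))))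

suffix-moreOnes : ∀ p b q → IsBallot (p ++ (b ∷ q)) → MoreOnes (b ∷ q)
suffix-moreOnes p b q (_ , suffixesOK) =
  subst MoreOnes (drop-length-++ p (b ∷ q))
    (All.lookup suffixesOK (∈-map⁺ (λ k → drop k (p ++ (b ∷ q))) (∈-zeroTo p<p++bq)))
  where
  p<p++bq : length p < length (p ++ (b ∷ q))
  p<p++bq = subst (length p <_) (sym (length-++ p)) (m<m+n (length p) (s≤s z≤n))

complement : List Bool → List Bool
complement = map not

complement-involutive : (c : List Bool) → complement (complement c) ≡ c
complement-involutive c = trans (sym (map-∘ c)) (trans (map-cong not-involutive c) (map-id c))

ones-complement : (c : List Bool) → ones (complement c) ≡ zeros c
ones-complement []          = refl
ones-complement (true ∷ c)  = ones-complement c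
ones-complement (false ∷ c) = cong suc (ones-complement c)

zeros-complement : (c : List Bool) → zeros (complement c) ≡ ones c
zeros-complement []          = refl
zeros-complement (true ∷ c)  = cong suc (zeros-complement c)
zeros-complement (false ∷ c) = zeros-complement c

-- A nonempty word c cannot end one ballot sequence while its complement
-- begins another: the first makes c have more ones, the second more zeros.
ballot-clash : ∀ p c q → c ≢ [] → IsBallot (p ++ c) → IsBallot (complement c ++ q) → ⊥
ballot-clash p []      q c≢[] _ _ = c≢[] refl
ballot-clash p (b ∷ c) q _ ends begins =
  <-asym (suffix-moreOnes p b c ends)
         (subst₂ _<_ (zeros-complement (b ∷ c)) (ones-complement (b ∷ c))
                 (prefix-moreOnes (not b) (complement c) q begins))

data Overlap (a b a' b' : List X) : Set where
  same-cut    : a ≡ a' → b ≡ b' → Overlap a b a' b'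
  later-cut   : ∀ c → c ≢ [] → a' ≡ a ++ c → b ≡ c ++ b' → Overlap a b a' b'
  earlier-cut : ∀ c → c ≢ [] → a ≡ a' ++ c → b' ≡ c ++ b → Overlap a b a' b'

compare-cuts : (a b a' b' : List X) → a ++ b ≡ a' ++ b' → Overlap a b a' b'
compare-cuts []      b []       b' e = same-cut refl e
compare-cuts []      b (x ∷ a') b' e = later-cut (x ∷ a') (λ ()) refl e
compare-cuts (x ∷ a) b []       b' e = earlier-cut (x ∷ a) (λ ()) refl (sym e)
compare-cuts (x ∷ a) b (y ∷ a') b' e with refl ← cong head e | compare-cuts a b a' b' (cong (drop 1) e)
... | same-cut a≡a' b≡b'           = same-cut (cong (x ∷_) a≡a') b≡b'
... | later-cut c c≢[] a'≡ b≡      = later-cut c c≢[] (cong (x ∷_) a'≡) b≡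
... | earlier-cut c c≢[] a≡ b'≡    = earlier-cut c c≢[] (cong (x ∷_) a≡) b'≡

no-later-cut : ∀ u v u' v' c → c ≢ [] → IsBallot (u ++ v) → IsBallot (u' ++ v') →
  v' ≡ v ++ c → complement u ≡ c ++ complement u' → ⊥
no-later-cut u v u' v' c c≢[] x-ballot x'-ballot refl ū≡cū' =
  ballot-clash (u' ++ v) c (u' ++ v) c≢[]
    (subst IsBallot (sym (++-assoc u' v c)) x'-ballot)
    (subst IsBallot (trans (cong (_++ v) u≡c̄u') (++-assoc (complement c) u' v)) x-ballot)
  where
  open ≡-Reasoning
  u≡c̄u' : u ≡ complement c ++ u'
  u≡c̄u' = begin
    u                                            ≡⟨ sym (complement-involutive u) ⟩
    complement (complement u)                    ≡⟨ cong complement ū≡cū' ⟩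
    complement (c ++ complement u')              ≡⟨ map-++ not c (complement u') ⟩
    complement c ++ complement (complement u')   ≡⟨ cong (complement c ++_) (complement-involutive u') ⟩
    complement c ++ u'                           ∎

cut-unique : ∀ u v u' v' → IsBallot (u ++ v) → IsBallot (u' ++ v') →
  v ++ complement u ≡ v' ++ complement u' → u ≡ u' × v ≡ v'
cut-unique u v u' v' x-ballot x'-ballot e with compare-cuts v (complement u) v' (complement u') e
... | same-cut v≡v' ū≡ū' =
  trans (sym (complement-involutive u)) (trans (cong complement ū≡ū') (complement-involutive u')) , v≡v'
... | later-cut c c≢[] v'≡vc ū≡cū' = ⊥-elim (no-later-cut u v u' v' c c≢[] x-ballot x'-ballot v'≡vc ū≡cū')
... | earlier-cut c c≢[] v≡v'c ū'≡cū = ⊥-elim (no-later-cut u' v' u v c c≢[] x'-ballot x-ballot v≡v'c ū'≡cū)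

rotate : ℕ → List Bool → List Bool
rotate k x = drop k x ++ complement (take k x)

length-rotate : ∀ k x → length (rotate k x) ≡ length x
length-rotate k x = begin
  length (drop k x ++ complement (take k x))          ≡⟨ length-++ (drop k x) ⟩
  length (drop k x) + length (complement (take k x))  ≡⟨ cong (length (drop k x) +_) (length-map not (take k x)) ⟩
  length (drop k x) + length (take k x)               ≡⟨ +-comm (length (drop k x)) _ ⟩
  length (take k x) + length (drop k x)               ≡⟨ sym (length-++ (take k x)) ⟩
  length (take k x ++ drop k x)                       ≡⟨ cong length (take++drop≡id k x) ⟩
  length x                                            ∎
  where open ≡-Reasoning

rotate-injective : ∀ {k k' x x'} → IsBallot x → IsBallot x' → k ≤ length x → k' ≤ length x' →
  rotate k x ≡ rotate k' x' → k ≡ k' × x ≡ x'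
rotate-injective {k} {k'} {x} {x'} x-ballot x'-ballot k≤ k'≤ e
  with take≡ , drop≡ ← cut-unique (take k x) (drop k x) (take k' x') (drop k' x')
                         (subst IsBallot (sym (take++drop≡id k x)) x-ballot)
                         (subst IsBallot (sym (take++drop≡id k' x')) x'-ballot) e =
  k≡k' , x≡x'
  where
  open ≡-Reasoning
  k≡k' : k ≡ k'
  k≡k' = begin
    k                    ≡⟨ sym (m≤n⇒m⊓n≡m k≤) ⟩
    k ⊓ length x        ≡⟨ sym (length-take k x) ⟩
    length (take k x)    ≡⟨ cong length take≡ ⟩
    length (take k' x')  ≡⟨ length-take k' x' ⟩
    k' ⊓ length x'      ≡⟨ m≤n⇒m⊓n≡m k'≤ ⟩
    k'                   ∎
  x≡x' : x ≡ x'
  x≡x' = begin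
    x                      ≡⟨ sym (take++drop≡id k x) ⟩
    take k x ++ drop k x   ≡⟨ cong₂ _++_ take≡ drop≡ ⟩
    take k' x' ++ drop k' x' ≡⟨ take++drop≡id k' x' ⟩
    x'                     ∎

ballots : ℕ → List (List Bool)
ballots ℓ = filter isBallot? (allSeqs ℓ)

cuts : ℕ → List (ℕ × List Bool)
cuts ℓ = cartesianProduct (upTo ℓ) (ballots ℓ)

∈-cuts⁻ : ∀ ℓ {k x} → (k , x) ∈ cuts ℓ → k < ℓ × length x ≡ ℓ × IsBallot x
∈-cuts⁻ ℓ k,x∈ with k∈ , x∈ ← ∈-cartesianProduct⁻ (upTo ℓ) (ballots ℓ) k,x∈
                 with x∈allSeqs , x-ballot ← ∈-filter⁻ isBallot? x∈ =
  ∈-upTo⁻ k∈ , ∈-allSeqs⁻ ℓ x∈allSeqs , x-ballot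

length-cuts : ∀ ℓ → length (cuts ℓ) ≡ ℓ * B ℓ
length-cuts ℓ = trans (length-cartesianProduct (upTo ℓ) (ballots ℓ)) (cong (_* B ℓ) (length-upTo ℓ))

cuts-unique : ∀ ℓ → Unique (cuts ℓ)
cuts-unique ℓ = cartesianProduct⁺ (upTo⁺ ℓ) (filter⁺ isBallot? (allSeqs-unique ℓ))

rotate-pair : ℕ × List Bool → List Bool
rotate-pair (k , x) = rotate k x

rotate-pair-into : ∀ ℓ {p} → p ∈ cuts ℓ → rotate-pair p ∈ allSeqs ℓ
rotate-pair-into ℓ {k , x} p∈ with _ , |x|≡ℓ , _ ← ∈-cuts⁻ ℓ p∈ =
  subst (λ n → rotate k x ∈ allSeqs n) (trans (length-rotate k x) |x|≡ℓ) (∈-allSeqs⁺ (rotate k x))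

rotate-pair-injective : ∀ ℓ {p q} → p ∈ cuts ℓ → q ∈ cuts ℓ → rotate-pair p ≡ rotate-pair q → p ≡ q
rotate-pair-injective ℓ {k , x} {k' , x'} p∈ q∈ e
  with k<ℓ , |x|≡ℓ , x-ballot ← ∈-cuts⁻ ℓ p∈
     | k'<ℓ , |x'|≡ℓ , x'-ballot ← ∈-cuts⁻ ℓ q∈
     with k≡k' , x≡x' ← rotate-injective x-ballot x'-ballot
                          (subst (k ≤_) (sym |x|≡ℓ) (<⇒≤ k<ℓ)) (subst (k' ≤_) (sym |x'|≡ℓ) (<⇒≤ k'<ℓ)) e =
  cong₂ _,_ k≡k' x≡x'

ballot-bound : ∀ ℓ → ℓ * B ℓ ≤ 2 ^ ℓ
ballot-bound ℓ = subst₂ _≤_ (length-cuts ℓ) (length-allSeqs ℓ)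
  (injectiveOn-length-≤ rotate-pair (cuts-unique ℓ) (rotate-pair-into ℓ) (rotate-pair-injective ℓ))

corollary4p9 : (k : ℕ) → let ℓ = suc (2 * k) in ℓ * B ℓ ≤ 2 ^ ℓ
corollary4p9 k = ballot-bound (suc (2 * k))
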